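{- Let $G$ be a graph, $R\subseteq V(G)$ with $|R|\ge 2$, and let $T_1,\dots,T_k$ be $R$-Steiner trees of $G$. Then $\{T_1,\dots,T_k\}$ is an $R$-CIST of $G$ if and only if $E(T_i)\cap E(T_j)=\emptyset$ and $\mathrm{int}(T_i)\cap\mathrm{int}(T_j)=\emptyset$ for all distinct $i,j\in[k]$.
   Context: Graphs are finite and connected, may have parallel edges but no loops. For a tree $T$, a vertex $v$ is an internal node if $d_T(v)\ge 2$, and a leaf otherwise; $\mathrm{int}(T)$ and $L(T)$ denote the sets of internal nodes and leaves. For $R\subseteq V(G)$ with $|R|\ge 2$, an $R$-Steiner tree is a subtree $T$ of $G$ with $R\subseteq V(T)$ and $L(T)\subseteq R$. $T(u,v)$ denotes the unique $(u,v)$-path in a tree $T$. An $R$-CIST of $G$ is a set $\{T_1,\dots,T_k\}$ of $R$-Steiner trees such that for every pair of distinct $u,v\in R$ and all distinct $i,j\in[k]$, the paths $T_i(u,v)$ and $T_j(u,v)$ are edge-disjoint and internally vertex-disjoint. -}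

module Defs where

open import Data.Nat using (ℕ; _≤_; _<_)
open import Data.Fin using (Fin; _≟_)
open import Data.Fin.Subset using (Subset; _∈_; _∉_; _⊆_; ∣_∣)
open import Data.Fin.Subset.Properties using (_∈?_)
open import Data.Product using (Σ; ∃; _×_; _,_; proj₁; proj₂)
open import Data.Product.Properties using ()
open import Data.Sum using (_⊎_)
open import Data.List using (List; []; _∷_; length; filter)
open import Data.List.Base using (allFin)
open import Data.List.Membership.Propositional as L using ()
open import Data.List.Relation.Unary.All using (All)
open import Data.List.Relation.Unary.Unique.Propositional using (Unique)
open import Relation.Nullary using (¬_; Dec)
open import Relation.Nullary.Decidable using (_×-dec_; _⊎-dec_)
open import Relation.Binary.PropositionalEquality using (_≡_; _≢_)

-- A finite multigraph without loops: vertices Fin n, edges Fin m,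
-- each edge has two (distinct) endpoints; parallel edges allowed.
record Graph : Set where
  field
    n    : ℕ
    m    : ℕ
    ends : Fin m → Fin n × Fin n
    loopless : ∀ e → proj₁ (ends e) ≢ proj₂ (ends e)

  Vertex = Fin n
  Edge   = Fin m

  Incident : Edge → Vertex → Set
  Incident e v = v ≡ proj₁ (ends e) ⊎ v ≡ proj₂ (ends e)

  incident? : ∀ e v → Dec (Incident e v)
  incident? e v = (v ≟ proj₁ (ends e)) ⊎-dec (v ≟ proj₂ (ends e))

  Joins : Edge → Vertex → Vertex → Set
  Joins e u v = (proj₁ (ends e) ≡ u × proj₂ (ends e) ≡ v)
              ⊎ (proj₁ (ends e) ≡ v × proj₂ (ends e) ≡ u)

  data Walk : Vertex → Vertex → Set where
    []   : ∀ {u} → Walk u u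
    step : ∀ {u w v} (e : Edge) → Joins e u w → Walk w v → Walk u v

  edges : ∀ {u v} → Walk u v → List Edge
  edges []           = []
  edges (step e _ p) = e ∷ edges p

  verts : ∀ {u v} → Walk u v → List Vertex
  verts {u} []       = u ∷ []
  verts {u} (step e _ p) = u ∷ verts p

  initVerts : ∀ {u v} → Walk u v → List Vertex
  initVerts []               = []
  initVerts {u} (step _ _ p) = u ∷ initVerts p

  innerVerts : ∀ {u v} → Walk u v → List Vertex
  innerVerts []           = []
  innerVerts (step _ _ p) = initVerts p

  IsPath : ∀ {u v} → Walk u v → Set
  IsPath p = Unique (verts p)

  Connected : Set
  Connected = ∀ (u v : Vertex) → Walk u v

  record Subgraph : Set where
    field
      V : Subset n
      E : Subset m
      closed : ∀ e → e ∈ E → proj₁ (ends e) ∈ V × proj₂ (ends e) ∈ V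

  module _ (H : Subgraph) where
    open Subgraph H

    WalkIn : ∀ {u v} → Walk u v → Set
    WalkIn p = All (_∈ E) (edges p) × All (_∈ V) (verts p)

    PathIn : Vertex → Vertex → Set
    PathIn u v = Σ (Walk u v) λ p → IsPath p × WalkIn p

    deg : Vertex → ℕ
    deg v = length (filter (λ e → (e ∈? E) ×-dec incident? e v) (allFin m))

    IsConnected : Set
    IsConnected = ∀ u v → u ∈ V → v ∈ V → PathIn u v

    HasCycle : Set
    HasCycle = Σ Edge λ e → Σ Vertex λ u → Σ Vertex λ w →
                 e ∈ E × Joins e u w ×
                 Σ (PathIn w u) λ P → ¬ (e L.∈ edges (proj₁ P))

    IsTree : Set
    IsTree = IsConnected × ¬ HasCycle

    Internal : Vertex → Set
    Internal v = v ∈ V × 2 ≤ deg v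

    Leaf : Vertex → Set
    Leaf v = v ∈ V × deg v < 2

  record SteinerTree (R : Subset n) : Set where
    field
      T      : Subgraph
      tree   : IsTree T
      covers : R ⊆ Subgraph.V T
      leaves : ∀ v → Leaf T v → v ∈ R

  open SteinerTree public

  -- {T_1..T_k} is an R-CIST: for distinct u,v ∈ R and distinct i,j, the
  -- (unique) paths T_i(u,v), T_j(u,v) are edge-disjoint and internally
  -- vertex-disjoint.
  IsCIST : (R : Subset n) (k : ℕ) → (Fin k → SteinerTree R) → Set
  IsCIST R k Ts = ∀ (u v : Vertex) → u ∈ R → v ∈ R → u ≢ v →
    ∀ (i j : Fin k) → i ≢ j →
    ∀ (P : PathIn (T (Ts i)) u v) (Q : PathIn (T (Ts j)) u v) →
      (∀ e → e L.∈ edges (proj₁ P) → ¬ (e L.∈ edges (proj₁ Q))) ×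
      (∀ x → x L.∈ innerVerts (proj₁ P) → ¬ (x L.∈ innerVerts (proj₁ Q)))

{-# OPTIONS --safe #-}
-- Paths of a tree use only its edges, and an inner vertex of a path meets two of its edges, hence is
-- internal; so disjoint trees form a CIST. Conversely, let e be an edge of both T_i and T_j. A walk
-- away from either end of e that never stops outside R (a vertex outside R is no leaf, and by
-- acyclicity the walk stays a path) reaches a terminal; so e separates two terminals in each tree.
-- Connectivity in T_i − e and in T_j − e are partial equivalences on R, and by the CIST condition any
-- two terminals are related by one of them, since otherwise both tree paths between them use e. Two
-- such relations cannot both have two classes. A common internal vertex v is excluded in the same way
-- with T − v, starting the walks along two edges at v.
module Submission where

open import Defs
open import Level using (Level; 0ℓ; _⊔_)
open import Data.Nat using (ℕ; zero; suc; _+_; _≤_; _<_; z≤n; s≤s; z<s)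
open import Data.Nat.Properties using (<⇒≱; ≮⇒≥; +-suc; +-identityʳ; m<n+m)
open import Data.Fin using (Fin; _≟_)
open import Data.Fin.Subset using (Subset; _∈_; ∣_∣)
open import Data.Fin.Subset.Properties using (_∈?_)
open import Data.Product using (Σ; Σ-syntax; _×_; _,_; proj₁; proj₂; swap)
open import Data.Sum using (_⊎_; inj₁; inj₂; [_,_]; [_,_]′)
import Data.Sum as Sum
open import Data.Empty using (⊥; ⊥-elim)
open import Data.List using (List; []; _∷_; _++_; length; allFin)
open import Data.List.Properties using (length-++-sucʳ; length-tabulate)
open import Data.List.Membership.Propositional using () renaming (_∈_ to _∈ₗ_; _∉_ to _∉ₗ_)
open import Data.List.Membership.Propositional.Properties
  using (∈-∃++; ∈-++⁺ˡ; ∈-++⁺ʳ; ∈-++⁻; ∈-filter⁺; ∈-filter⁻; ∈-allFin)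
open import Data.List.Relation.Binary.Subset.Propositional using () renaming (_⊆_ to _⊆ₗ_)
open import Data.List.Relation.Unary.Any using (here; there; any?)
open import Data.List.Relation.Unary.All as All using (All; []; _∷_)
open import Data.List.Relation.Unary.All.Properties using (¬Any⇒All¬; All¬⇒¬Any)
open import Data.List.Relation.Unary.AllPairs using ([]; _∷_)
open import Data.List.Relation.Unary.Unique.Propositional using (Unique)
open import Data.List.Relation.Unary.Unique.Propositional.Properties using (filter⁺; allFin⁺)
open import Function using (id)
open import Function.Bundles using (_⇔_; mk⇔)
open import Relation.Nullary using (¬_; yes; no)
open import Relation.Nullary.Decidable using (_×-dec_)
open import Relation.Unary using (Pred; Decidable)
open import Relation.Binary using (Rel; IsPartialEquivalence)
open import Relation.Binary.PropositionalEquality using (_≡_; _≢_; refl; sym; subst)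

unique-⊆⇒length≤ : ∀ {a} {A : Set a} {xs ys : List A} → Unique xs → xs ⊆ₗ ys → length xs ≤ length ys
unique-⊆⇒length≤ {xs = []} _ _ = z≤n
unique-⊆⇒length≤ {xs = x ∷ xs} (x∉xs ∷ uniq) x∷xs⊆ys with ∈-∃++ (x∷xs⊆ys (here refl))
... | as , bs , refl =
  subst (suc (length xs) ≤_) (sym (length-++-sucʳ as x bs)) (s≤s (unique-⊆⇒length≤ uniq xs⊆as++bs))
  where
  xs⊆as++bs : xs ⊆ₗ as ++ bs
  xs⊆as++bs y∈xs with ∈-++⁻ as (x∷xs⊆ys (there y∈xs))
  ... | inj₁ y∈as         = ∈-++⁺ˡ y∈as
  ... | inj₂ (here y≡x)   = ⊥-elim (All.lookup x∉xs y∈xs (sym y≡x))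
  ... | inj₂ (there y∈bs) = ∈-++⁺ʳ as y∈bs

unique⇒length≤ : ∀ {n} {xs : List (Fin n)} → Unique xs → length xs ≤ n
unique⇒length≤ {n} {xs} uniq =
  subst (length xs ≤_) (length-tabulate {n = n} id) (unique-⊆⇒length≤ uniq (λ {x} _ → ∈-allFin x))

distinct⇒2≤length : ∀ {a} {A : Set a} {x y : A} {xs} → x ≢ y → x ∈ₗ xs → y ∈ₗ xs → 2 ≤ length xs
distinct⇒2≤length x≢y x∈xs y∈xs =
  unique-⊆⇒length≤ ((x≢y ∷ []) ∷ [] ∷ []) λ { (here refl) → x∈xs ; (there (here refl)) → y∈xs }

2≤length⇒distinct : ∀ {a} {A : Set a} {xs : List A} → Unique xs → 2 ≤ length xs →
  Σ[ x ∈ A ] Σ[ y ∈ A ] x ≢ y × x ∈ₗ xs × y ∈ₗ xs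
2≤length⇒distinct {xs = x ∷ y ∷ _} ((x≢y ∷ _) ∷ _) _ = x , y , x≢y , here refl , there (here refl)
2≤length⇒distinct {xs = _ ∷ []}    _                (s≤s ())

HasSeparatedPair : ∀ {a p ℓ} {A : Set a} → Pred A p → Rel A ℓ → Set (a ⊔ p ⊔ ℓ)
HasSeparatedPair {A = A} P _~_ = Σ[ x ∈ A ] Σ[ y ∈ A ] P x × P y × ¬ x ~ y

union-total⇒¬both-separated :
  ∀ {a p ℓ₁ ℓ₂} {A : Set a} {P : Pred A p} {_~₁_ : Rel A ℓ₁} {_~₂_ : Rel A ℓ₂} →
  IsPartialEquivalence _~₁_ → IsPartialEquivalence _~₂_ → (∀ {x y} → P x → P y → x ~₁ y ⊎ x ~₂ y) →
  HasSeparatedPair P _~₁_ → ¬ HasSeparatedPair P _~₂_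
union-total⇒¬both-separated {P = P} {_~₁_} {_~₂_} per₁ per₂ total
  (r₁ , r₂ , Pr₁ , Pr₂ , r₁≁r₂) (q₁ , q₂ , Pq₁ , Pq₂ , q₁≁q₂) =
  q₁≁q₂ (trans₂ (~₂r₁ Pq₁) (sym₂ (~₂r₁ Pq₂)))
  where
  open IsPartialEquivalence per₁ renaming (sym to sym₁; trans to trans₁)
  open IsPartialEquivalence per₂ renaming (sym to sym₂; trans to trans₂)
  r₁~₂r₂ : r₁ ~₂ r₂
  r₁~₂r₂ = [ (λ r₁~₁r₂ → ⊥-elim (r₁≁r₂ r₁~₁r₂)) , id ] (total Pr₁ Pr₂)
  ~₂r₁ : ∀ {q} → P q → q ~₂ r₁
  ~₂r₁ Pq with total Pq Pr₁ | total Pq Pr₂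
  ... | inj₂ q~₂r₁ | _          = q~₂r₁
  ... | inj₁ _     | inj₂ q~₂r₂ = trans₂ q~₂r₂ (sym₂ r₁~₂r₂)
  ... | inj₁ q~₁r₁ | inj₁ q~₁r₂ = ⊥-elim (r₁≁r₂ (trans₁ (sym₁ q~₁r₁) q~₁r₂))

one-of : ∀ {a b c d} {A : Set a} {B : Set b} {C : Set c} {D : Set d} →
  A ⊎ C → B ⊎ D → (C → D → ⊥) → A ⊎ B
one-of (inj₁ a) _        _   = inj₁ a
one-of (inj₂ _) (inj₁ b) _   = inj₂ b
one-of (inj₂ c) (inj₂ d) c→¬d = ⊥-elim (c→¬d c d)

module Walks (G : Graph) where
  open Graph G

  private variable
    a b c u v w x : Vertex
    e : Edge

  joins-sym : Joins e u v → Joins e v u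
  joins-sym (inj₁ (p , q)) = inj₂ (p , q)
  joins-sym (inj₂ (p , q)) = inj₁ (p , q)

  joins-distinct : Joins e u v → u ≢ v
  joins-distinct {e} (inj₁ (refl , refl)) = loopless e
  joins-distinct {e} (inj₂ (refl , refl)) = λ eq → loopless e (sym eq)

  ends-joined : (e : Edge) → Joins e (proj₁ (ends e)) (proj₂ (ends e))
  ends-joined e = inj₁ (refl , refl)

  joins-incidentˡ : Joins e u v → Incident e u
  joins-incidentˡ (inj₁ (refl , _)) = inj₁ refl
  joins-incidentˡ (inj₂ (_ , refl)) = inj₂ refl

  joins-incidentʳ : Joins e u v → Incident e v
  joins-incidentʳ j = joins-incidentˡ (joins-sym j)

  incident-joins : Joins e u v → Incident e x → x ≡ u ⊎ x ≡ v
  incident-joins (inj₁ (refl , refl)) i = i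
  incident-joins (inj₂ (refl , refl)) i = Sum.swap i

  other-end : Incident e v → Σ[ u ∈ Vertex ] Joins e u v
  other-end {e} (inj₁ refl) = proj₂ (ends e) , inj₂ (refl , refl)
  other-end {e} (inj₂ refl) = proj₁ (ends e) , inj₁ (refl , refl)

  infixr 5 _++ʷ_
  _++ʷ_ : Walk a b → Walk b c → Walk a c
  []           ++ʷ q = q
  step e j p   ++ʷ q = step e j (p ++ʷ q)

  reverse : Walk a b → Walk b a
  reverse []           = []
  reverse (step e j p) = reverse p ++ʷ step e (joins-sym j) []

  source∈verts : (p : Walk a b) → a ∈ₗ verts p
  source∈verts []           = here refl
  source∈verts (step _ _ _) = here refl

  target∈verts : (p : Walk a b) → b ∈ₗ verts p
  target∈verts []           = here refl
  target∈verts (step _ _ p) = there (target∈verts p)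

  incident∈verts : Incident e x → (p : Walk a b) → e ∈ₗ edges p → x ∈ₗ verts p
  incident∈verts i (step _ j p) (here refl) =
    [ here , (λ { refl → there (source∈verts p) }) ]′ (incident-joins j i)
  incident∈verts i (step _ _ p) (there e∈p) = there (incident∈verts i p e∈p)

  innerVerts⊆verts : (p : Walk a b) → innerVerts p ⊆ₗ verts p
  innerVerts⊆verts (step _ _ p) x∈ = there (initVerts⊆verts p x∈)
    where
    initVerts⊆verts : (p : Walk a b) → initVerts p ⊆ₗ verts p
    initVerts⊆verts (step _ _ p) (here eq)  = here eq
    initVerts⊆verts (step _ _ p) (there x∈) = there (initVerts⊆verts p x∈)

  ∈verts⇒∈initVerts : (p : Walk a b) → x ∈ₗ verts p → x ≢ b → x ∈ₗ initVerts p
  ∈verts⇒∈initVerts []           (here refl) x≢b = ⊥-elim (x≢b refl)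
  ∈verts⇒∈initVerts (step _ _ p) (here eq)   _   = here eq
  ∈verts⇒∈initVerts (step _ _ p) (there x∈)  x≢b = there (∈verts⇒∈initVerts p x∈ x≢b)

  ∈verts⇒∈innerVerts : (p : Walk a b) → x ∈ₗ verts p → x ≢ a → x ≢ b → x ∈ₗ innerVerts p
  ∈verts⇒∈innerVerts []           (here refl) x≢a _   = ⊥-elim (x≢a refl)
  ∈verts⇒∈innerVerts (step _ _ p) (here refl) x≢a _   = ⊥-elim (x≢a refl)
  ∈verts⇒∈innerVerts (step _ _ p) (there x∈)  _   x≢b = ∈verts⇒∈initVerts p x∈ x≢b

  step-path-target≢source : ∀ {f} (j : Joins f a w) (p : Walk w b) → IsPath (step f j p) → b ≢ a
  step-path-target≢source _ p (a∉p ∷ _) b≡a = All.lookup a∉p (target∈verts p) (sym b≡a)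

  closed-path-has-no-edge : (p : Walk a a) → IsPath p → e ∉ₗ edges p
  closed-path-has-no-edge (step _ j p) isPath _ = step-path-target≢source j p isPath refl

  closed-path-has-no-inner : (p : Walk a a) → IsPath p → x ∉ₗ innerVerts p
  closed-path-has-no-inner (step _ j p) isPath _ = step-path-target≢source j p isPath refl

  inner-vertex-edges : (p : Walk a b) → IsPath p → x ∈ₗ innerVerts p →
    Σ[ g₁ ∈ Edge ] Σ[ g₂ ∈ Edge ] g₁ ≢ g₂ × g₁ ∈ₗ edges p × g₂ ∈ₗ edges p × Incident g₁ x × Incident g₂ x
  inner-vertex-edges (step f j (step f′ j′ p)) (a∉ ∷ _) (here refl) =
    f , f′ , f≢f′ , here refl , there (here refl) , joins-incidentʳ j , joins-incidentˡ j′
    where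
    f≢f′ : f ≢ f′
    f≢f′ refl = All.lookup a∉ (incident∈verts (joins-incidentˡ j) (step f j′ p) (here refl)) refl
  inner-vertex-edges (step _ _ (step f′ j′ p)) (_ ∷ isPath) (there x∈)
    with inner-vertex-edges (step f′ j′ p) isPath x∈
  ... | g₁ , g₂ , g₁≢g₂ , g₁∈ , g₂∈ , i₁ , i₂ = g₁ , g₂ , g₁≢g₂ , there g₁∈ , there g₂∈ , i₁ , i₂

  module Restricted {ℓ₁ ℓ₂ : Level} (OkE : Pred Edge ℓ₁) (OkV : Pred Vertex ℓ₂) where

    Within : Walk a b → Set (ℓ₁ ⊔ ℓ₂)
    Within p = All OkE (edges p) × All OkV (verts p)

    Linked : Rel Vertex (ℓ₁ ⊔ ℓ₂)
    Linked a b = Σ (Walk a b) Within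

    linked-source : Linked a b → OkV a
    linked-source (p , _ , oks) = All.lookup oks (source∈verts p)

    within-++ʷ : (p : Walk a b) {q : Walk b c} → Within p → Within q → Within (p ++ʷ q)
    within-++ʷ []           _                  okq = okq
    within-++ʷ (step _ _ p) (oe ∷ oes , ov ∷ ovs) okq =
      let oes′ , ovs′ = within-++ʷ p (oes , ovs) okq in oe ∷ oes′ , ov ∷ ovs′

    within-reverse : (p : Walk a b) → Within p → Within (reverse p)
    within-reverse []           ok                    = ok
    within-reverse (step _ _ p) (oe ∷ oes , ov ∷ ovs) =
      within-++ʷ (reverse p) (within-reverse p (oes , ovs))
        (oe ∷ [] , All.lookup ovs (source∈verts p) ∷ ov ∷ [])

    linked-sym : Linked a b → Linked b a
    linked-sym (p , ok) = reverse p , within-reverse p ok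

    linked-trans : Linked a b → Linked b c → Linked a c
    linked-trans (p , okp) (q , okq) = p ++ʷ q , within-++ʷ p okp okq

    linked-isPartialEquivalence : IsPartialEquivalence Linked
    linked-isPartialEquivalence = record { sym = linked-sym ; trans = linked-trans }

    linked-prefix : (p : Walk a b) → x ∈ₗ verts p → Within p → Linked a x
    linked-prefix []           (here refl) ok                 = [] , ok
    linked-prefix (step _ _ p) (here refl) (_ , ov ∷ _)       = [] , [] , ov ∷ []
    linked-prefix (step e j p) (there x∈)  (oe ∷ oes , ov ∷ ovs) with linked-prefix p x∈ (oes , ovs)
    ... | q , oes′ , ovs′ = step e j q , oe ∷ oes′ , ov ∷ ovs′

    erase-loops : (p : Walk a b) → Within p → Σ[ q ∈ Walk a b ] IsPath q × Within q
    erase-loops []               ok                    = [] , [] ∷ [] , ok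
    erase-loops {a} (step e j p) (oe ∷ oes , ov ∷ ovs) with erase-loops p (oes , ovs)
    ... | q , isPath , oes′ , ovs′ with any? (a ≟_) (verts q)
    ...   | no a∉q  = step e j q , ¬Any⇒All¬ _ a∉q ∷ isPath , oe ∷ oes′ , ov ∷ ovs′
    ...   | yes a∈q = suffix q a∈q isPath (oes′ , ovs′)
      where
      suffix : (q : Walk x b) → a ∈ₗ verts q → IsPath q → Within q →
        Σ[ s ∈ Walk a b ] IsPath s × Within s
      suffix []           (here refl) isPath ok = [] , isPath , ok
      suffix (step e j q) (here refl) isPath ok = step e j q , isPath , ok
      suffix (step _ _ q) (there a∈)  (_ ∷ isPath) (_ ∷ oes , _ ∷ ovs) = suffix q a∈ isPath (oes , ovs)

module Subgraphs (G : Graph) (H : Graph.Subgraph G) where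
  open Graph G
  open Subgraph H
  open Walks G

  private variable
    a b u v x z : Vertex
    e : Edge

  E∖ : Edge → Pred Edge 0ℓ
  E∖ e g = g ∈ E × e ≢ g

  V∖ : Vertex → Pred Vertex 0ℓ
  V∖ x v = v ∈ V × x ≢ v

  module WithoutEdge (e : Edge) = Restricted (E∖ e) (_∈ V)
  module WithoutVertex (x : Vertex) = Restricted (_∈ E) (V∖ x)

  LinkedWithoutEdge : Edge → Rel Vertex 0ℓ
  LinkedWithoutEdge = WithoutEdge.Linked

  LinkedWithoutVertex : Vertex → Rel Vertex 0ℓ
  LinkedWithoutVertex = WithoutVertex.Linked

  joins-closed : e ∈ E → Joins e u v → u ∈ V × v ∈ V
  joins-closed {e} e∈E (inj₁ (refl , refl)) = closed e e∈E
  joins-closed {e} e∈E (inj₂ (refl , refl)) = swap (closed e e∈E)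

  linked-without-vertex⇒edge : Incident e x → LinkedWithoutVertex x u v → LinkedWithoutEdge e u v
  linked-without-vertex⇒edge {e} i (p , oes , ovs) = p , All.tabulate avoids-e , All.map proj₁ ovs
    where
    avoids-e : ∀ {g} → g ∈ₗ edges p → g ∈ E × e ≢ g
    avoids-e g∈p = All.lookup oes g∈p , λ { refl → proj₂ (All.lookup ovs (incident∈verts i p g∈p)) refl }

  incident-in? : (z : Vertex) → Decidable (λ g → g ∈ E × Incident g z)
  incident-in? z g = (g ∈? E) ×-dec incident? g z

  deg≥2⇒two-edges : 2 ≤ deg H z →
    Σ[ g₁ ∈ Edge ] Σ[ g₂ ∈ Edge ] g₁ ≢ g₂ × (g₁ ∈ E × Incident g₁ z) × (g₂ ∈ E × Incident g₂ z)
  deg≥2⇒two-edges {z} deg≥2 with 2≤length⇒distinct (filter⁺ (incident-in? z) (allFin⁺ m)) deg≥2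
  ... | g₁ , g₂ , g₁≢g₂ , g₁∈ , g₂∈ =
    g₁ , g₂ , g₁≢g₂ , proj₂ (∈-filter⁻ (incident-in? z) {xs = allFin m} g₁∈) ,
    proj₂ (∈-filter⁻ (incident-in? z) {xs = allFin m} g₂∈)

  deg≥2⇒another-edge : 2 ≤ deg H z → (f : Edge) → Σ[ g ∈ Edge ] f ≢ g × g ∈ E × Incident g z
  deg≥2⇒another-edge deg≥2 f with deg≥2⇒two-edges deg≥2
  ... | g₁ , g₂ , g₁≢g₂ , i₁ , i₂ with f ≟ g₁
  ...   | yes refl = g₂ , g₁≢g₂ , i₂
  ...   | no  f≢g₁ = g₁ , f≢g₁ , i₁

  two-edges⇒deg≥2 : ∀ {g₁ g₂} → g₁ ≢ g₂ → g₁ ∈ E × Incident g₁ z → g₂ ∈ E × Incident g₂ z → 2 ≤ deg H z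
  two-edges⇒deg≥2 {z} {g₁} {g₂} g₁≢g₂ i₁ i₂ =
    distinct⇒2≤length g₁≢g₂ (∈-filter⁺ (incident-in? z) (∈-allFin g₁) i₁)
      (∈-filter⁺ (incident-in? z) (∈-allFin g₂) i₂)

  inner-vertex-internal : (P : PathIn H u v) → x ∈ₗ innerVerts (proj₁ P) → Internal H x
  inner-vertex-internal (p , isPath , oes , ovs) x∈ with inner-vertex-edges p isPath x∈
  ... | g₁ , g₂ , g₁≢g₂ , g₁∈ , g₂∈ , i₁ , i₂ =
    All.lookup ovs (innerVerts⊆verts p x∈) ,
    two-edges⇒deg≥2 g₁≢g₂ (All.lookup oes g₁∈ , i₁) (All.lookup oes g₂∈ , i₂)

  module _ (connected : IsConnected H) where

    linked-without-edge-or-crossing : u ∈ V → v ∈ V →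
      LinkedWithoutEdge e u v ⊎ Σ[ P ∈ PathIn H u v ] e ∈ₗ edges (proj₁ P)
    linked-without-edge-or-crossing {u} {v} {e} u∈V v∈V with connected u v u∈V v∈V
    ... | P@(p , _ , oes , ovs) with any? (e ≟_) (edges p)
    ...   | yes e∈p = inj₂ (P , e∈p)
    ...   | no  e∉p = inj₁ (p , All.zip (oes , ¬Any⇒All¬ _ e∉p) , ovs)

    linked-without-vertex-or-crossing : u ∈ V → v ∈ V → x ≢ u → x ≢ v →
      LinkedWithoutVertex x u v ⊎ Σ[ P ∈ PathIn H u v ] x ∈ₗ innerVerts (proj₁ P)
    linked-without-vertex-or-crossing {u} {v} {x} u∈V v∈V x≢u x≢v with connected u v u∈V v∈V
    ... | P@(p , _ , oes , ovs) with any? (x ≟_) (verts p)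
    ...   | yes x∈p = inj₂ (P , ∈verts⇒∈innerVerts p x∈p x≢u x≢v)
    ...   | no  x∉p = inj₁ (p , oes , All.zip (ovs , ¬Any⇒All¬ _ x∉p))

  module _ (acyclic : ¬ HasCycle H) where

    bridge : e ∈ E → Joins e u v → ¬ LinkedWithoutEdge e v u
    bridge {e} e∈E j (p , ok) with WithoutEdge.erase-loops e p ok
    ... | q , isPath , oes , ovs =
      acyclic (e , _ , _ , e∈E , j , (q , isPath , All.map proj₁ oes , ovs) ,
               All¬⇒¬Any (All.map proj₂ oes))

    cut-vertex : ∀ {g₁ g₂ a₁ a₂} → g₁ ≢ g₂ → g₁ ∈ E → g₂ ∈ E → Joins g₁ a₁ x → Joins g₂ a₂ x →
      ¬ LinkedWithoutVertex x a₁ a₂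
    cut-vertex {x} {g₁} {g₂} g₁≢g₂ g₁∈E g₂∈E j₁ j₂ a₁~a₂ =
      bridge g₁∈E (joins-sym j₁)
        (WithoutEdge.linked-trans g₁ (linked-without-vertex⇒edge (joins-incidentʳ j₁) a₁~a₂) a₂~x)
      where
      a₂~x : LinkedWithoutEdge g₁ _ x
      a₂~x = step g₂ j₂ [] , (g₂∈E , g₁≢g₂) ∷ [] ,
             proj₁ (joins-closed g₂∈E j₂) ∷ proj₂ (joins-closed g₂∈E j₂) ∷ []

    extend-path : ∀ {f w} (j : Joins f z w) (p : Walk w b) →
      IsPath (step f j p) → WalkIn H (step f j p) → 2 ≤ deg H z →
      Σ[ g ∈ Edge ] Σ[ z′ ∈ Vertex ] Joins g z′ z × g ∈ E × z′ ∈ V × z′ ∉ₗ verts (step f j p)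
    extend-path {f = f} j p isPath@(z∉p ∷ _) inH deg≥2 with deg≥2⇒another-edge deg≥2 f
    ... | g , f≢g , g∈E , i with other-end i
    ...   | z′ , j′ with any? (z′ ≟_) (verts (step f j p))
    ...     | no  z′∉ = g , z′ , j′ , g∈E , proj₁ (joins-closed g∈E j′) , z′∉
    ...     | yes z′∈ = ⊥-elim (bridge g∈E j′ (WithoutEdge.linked-prefix g (step f j p) z′∈ within))
      where
      g∉ : g ∉ₗ edges (step f j p)
      g∉ (here g≡f)  = f≢g (sym g≡f)
      g∉ (there g∈p) = All.lookup z∉p (incident∈verts i p g∈p) refl
      within : WithoutEdge.Within g (step f j p)
      within = All.zip (proj₁ inH , ¬Any⇒All¬ _ g∉) , proj₂ inH

module SteinerTrees (G : Graph) {R : Subset (Graph.n G)} (S : Graph.SteinerTree G R) where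
  open Graph G
  open Subgraph (T S)
  open Walks G
  open Subgraphs G (T S)

  private variable
    a b x z : Vertex
    e : Edge

  acyclic : ¬ HasCycle (T S)
  acyclic = proj₂ (tree S)

  non-terminal⇒deg≥2 : z ∈ V → ¬ z ∈ R → 2 ≤ deg (T S) z
  non-terminal⇒deg≥2 {z} z∈V z∉R = ≮⇒≥ (λ deg<2 → z∉R (leaves S z (z∈V , deg<2)))

  -- A path has at most n vertices, so the fuel never runs out.
  extend-to-terminal : ∀ (fuel : ℕ) {f w} (j : Joins f z w) (p : Walk w b) → IsPath (step f j p) →
    WalkIn (T S) (step f j p) → n < length (verts (step f j p)) + fuel →
    Σ[ r ∈ Vertex ] r ∈ R × LinkedWithoutVertex b r z
  extend-to-terminal zero j p isPath _ bound =
    ⊥-elim (<⇒≱ (subst (n <_) (+-identityʳ _) bound) (unique⇒length≤ isPath))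
  extend-to-terminal {z = z} {b = b} (suc fuel) j p isPath inH@(_ , z∈V ∷ _) bound with z ∈? R
  ... | yes z∈R = z , z∈R , [] , [] , (z∈V , step-path-target≢source j p isPath) ∷ []
  ... | no z∉R with extend-path acyclic j p isPath inH (non-terminal⇒deg≥2 z∈V z∉R)
  ...   | g , z′ , j′ , g∈E , z′∈V , z′∉ with extend-to-terminal fuel j′ (step _ j p)
            (¬Any⇒All¬ _ z′∉ ∷ isPath) (g∈E ∷ proj₁ inH , z′∈V ∷ proj₂ inH)
            (subst (n <_) (+-suc _ fuel) bound)
  ...     | r , r∈R , r~z′ = r , r∈R , WithoutVertex.linked-trans b r~z′ z′~z
    where
    z′~z : LinkedWithoutVertex b z′ z
    z′~z = step g j′ [] , g∈E ∷ [] ,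
           (z′∈V , λ { refl → z′∉ (target∈verts (step _ j p)) }) ∷
           (z∈V , step-path-target≢source j p isPath) ∷ []

  reach-terminal-avoiding : e ∈ E → Joins e a b → Σ[ r ∈ Vertex ] r ∈ R × LinkedWithoutVertex b r a
  reach-terminal-avoiding e∈E j = extend-to-terminal n j [] ((joins-distinct j ∷ []) ∷ [] ∷ [])
    (e∈E ∷ [] , proj₁ (joins-closed e∈E j) ∷ proj₂ (joins-closed e∈E j) ∷ []) (m<n+m n z<s)

  edge-separates-terminals : e ∈ E → Joins e a b → HasSeparatedPair (_∈ R) (LinkedWithoutEdge e)
  edge-separates-terminals {e} e∈E j
    with reach-terminal-avoiding e∈E j | reach-terminal-avoiding e∈E (joins-sym j)
  ... | r , r∈R , r~a | s , s∈R , s~b = r , s , r∈R , s∈R , λ r~s →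
    bridge acyclic e∈E j
      (linked-trans (linked-sym (avoiding-b⇒e s~b)) (linked-trans (linked-sym r~s) (avoiding-a⇒e r~a)))
    where
    open WithoutEdge e
    avoiding-a⇒e = linked-without-vertex⇒edge (joins-incidentʳ j)
    avoiding-b⇒e = linked-without-vertex⇒edge (joins-incidentˡ j)

  internal-vertex-separates-terminals : Internal (T S) x →
    HasSeparatedPair (λ r → r ∈ R × x ≢ r) (LinkedWithoutVertex x)
  internal-vertex-separates-terminals {x} (_ , deg≥2) with deg≥2⇒two-edges deg≥2
  ... | g₁ , g₂ , g₁≢g₂ , (g₁∈E , i₁) , (g₂∈E , i₂) with other-end i₁ | other-end i₂
  ...   | a₁ , j₁ | a₂ , j₂ with reach-terminal-avoiding g₁∈E j₁ | reach-terminal-avoiding g₂∈E j₂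
  ...     | r₁ , r₁∈R , r₁~a₁ | r₂ , r₂∈R , r₂~a₂ =
    r₁ , r₂ , (r₁∈R , proj₂ (linked-source r₁~a₁)) , (r₂∈R , proj₂ (linked-source r₂~a₂)) , λ r₁~r₂ →
    cut-vertex acyclic g₁≢g₂ g₁∈E g₂∈E j₁ j₂ (linked-trans (linked-sym r₁~a₁) (linked-trans r₁~r₂ r₂~a₂))
    where open WithoutVertex x

module SteinerTreePairs (G : Graph) {R : Subset (Graph.n G)} (S₁ S₂ : Graph.SteinerTree G R) where
  open Graph G
  open Walks G
  private
    module S₁ = SteinerTrees G S₁
    module S₂ = SteinerTrees G S₂
    module H₁ = Subgraphs G (T S₁)
    module H₂ = Subgraphs G (T S₂)

  CompletelyIndependent : Set
  CompletelyIndependent = ∀ (u v : Vertex) → u ∈ R → v ∈ R → u ≢ v →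
    ∀ (P : PathIn (T S₁) u v) (Q : PathIn (T S₂) u v) →
      (∀ e → e ∈ₗ edges (proj₁ P) → ¬ (e ∈ₗ edges (proj₁ Q))) ×
      (∀ x → x ∈ₗ innerVerts (proj₁ P) → ¬ (x ∈ₗ innerVerts (proj₁ Q)))

  EdgeDisjoint : Set
  EdgeDisjoint = ∀ e → e ∈ Subgraph.E (T S₁) → ¬ (e ∈ Subgraph.E (T S₂))

  InternallyDisjoint : Set
  InternallyDisjoint = ∀ v → Internal (T S₁) v → ¬ Internal (T S₂) v

  independent⇒edge-disjoint : CompletelyIndependent → EdgeDisjoint
  independent⇒edge-disjoint independent e e∈E₁ e∈E₂ =
    union-total⇒¬both-separated (H₁.WithoutEdge.linked-isPartialEquivalence e)
      (H₂.WithoutEdge.linked-isPartialEquivalence e) linked-in-one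
      (S₁.edge-separates-terminals e∈E₁ (ends-joined e))
      (S₂.edge-separates-terminals e∈E₂ (ends-joined e))
    where
    linked-in-one : ∀ {a b} → a ∈ R → b ∈ R → H₁.LinkedWithoutEdge e a b ⊎ H₂.LinkedWithoutEdge e a b
    linked-in-one {a} {b} a∈R b∈R = one-of
      (H₁.linked-without-edge-or-crossing (proj₁ (tree S₁)) (covers S₁ a∈R) (covers S₁ b∈R))
      (H₂.linked-without-edge-or-crossing (proj₁ (tree S₂)) (covers S₂ a∈R) (covers S₂ b∈R))
      λ (P , e∈P) (Q , e∈Q) →
        let a≢b = λ { refl → closed-path-has-no-edge (proj₁ P) (proj₁ (proj₂ P)) e∈P }
        in proj₁ (independent a b a∈R b∈R a≢b P Q) e e∈P e∈Q

  independent⇒internally-disjoint : CompletelyIndependent → InternallyDisjoint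
  independent⇒internally-disjoint independent x x-int₁ x-int₂ =
    union-total⇒¬both-separated (H₁.WithoutVertex.linked-isPartialEquivalence x)
      (H₂.WithoutVertex.linked-isPartialEquivalence x) linked-in-one
      (S₁.internal-vertex-separates-terminals x-int₁) (S₂.internal-vertex-separates-terminals x-int₂)
    where
    linked-in-one : ∀ {a b} → a ∈ R × x ≢ a → b ∈ R × x ≢ b →
      H₁.LinkedWithoutVertex x a b ⊎ H₂.LinkedWithoutVertex x a b
    linked-in-one {a} {b} (a∈R , x≢a) (b∈R , x≢b) = one-of
      (H₁.linked-without-vertex-or-crossing (proj₁ (tree S₁)) (covers S₁ a∈R) (covers S₁ b∈R) x≢a x≢b)
      (H₂.linked-without-vertex-or-crossing (proj₁ (tree S₂)) (covers S₂ a∈R) (covers S₂ b∈R) x≢a x≢b)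
      λ (P , x∈P) (Q , x∈Q) →
        let a≢b = λ { refl → closed-path-has-no-inner (proj₁ P) (proj₁ (proj₂ P)) x∈P }
        in proj₂ (independent a b a∈R b∈R a≢b P Q) x x∈P x∈Q

  disjoint⇒independent : EdgeDisjoint → InternallyDisjoint → CompletelyIndependent
  disjoint⇒independent edge-disjoint internally-disjoint _ _ _ _ _ P@(_ , _ , oes₁ , _) Q@(_ , _ , oes₂ , _) =
    (λ e e∈P e∈Q → edge-disjoint e (All.lookup oes₁ e∈P) (All.lookup oes₂ e∈Q)) ,
    (λ x x∈P x∈Q →
      internally-disjoint x (H₁.inner-vertex-internal P x∈P) (H₂.inner-vertex-internal Q x∈Q))

open SteinerTreePairs

theorem3p2 : (G : Graph) → Graph.Connected G →
    (R : Subset (Graph.n G)) → 2 ≤ ∣ R ∣ →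
    (k : ℕ) (Ts : Fin k → Graph.SteinerTree G R) →
    Graph.IsCIST G R k Ts ⇔
      (∀ (i j : Fin k) → i ≢ j →
        (∀ e → e ∈ Graph.Subgraph.E (Graph.T (Ts i)) → ¬ (e ∈ Graph.Subgraph.E (Graph.T (Ts j)))) ×
        (∀ v → Graph.Internal G (Graph.T (Ts i)) v → ¬ Graph.Internal G (Graph.T (Ts j)) v))
theorem3p2 G _ R _ k Ts = mk⇔
  (λ cist i j i≢j → let independent = λ u v u∈R v∈R u≢v → cist u v u∈R v∈R u≢v i j i≢j in
    independent⇒edge-disjoint G (Ts i) (Ts j) independent ,
    independent⇒internally-disjoint G (Ts i) (Ts j) independent)
  (λ disjoint u v u∈R v∈R u≢v i j i≢j →
    let edge-disjoint , internally-disjoint = disjoint i j i≢j in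
    disjoint⇒independent G (Ts i) (Ts j) edge-disjoint internally-disjoint u v u∈R v∈R u≢v)
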